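{- Let $G=(V,E)$ be a bidirected graph and let $X\subseteq E$ be balanced. Then $X$ is representable as the union of pairwise edge-disjoint small cycles of $G$ (each cycle regarded as its edge set).
   Context: A bidirected graph $G=(V,E)$ is a graph in which each edge $e$ with ends $u,v$ (possibly $u=v$, a loop) is of one of three types: a directed edge leaving one end and entering the other; an edge leaving both ends; or an edge entering both ends. No loop both enters and leaves its end node. A walk is an alternating sequence $P=(v_0,e_1,v_1,\ldots,e_k,v_k)$ of nodes and edges with each $e_i$ connecting $v_{i-1}$ and $v_i$ and, for $i=1,\ldots,k-1$, $e_i,e_{i+1}$ forming a transit pair at $v_i$ (one enters $v_i$, the other leaves $v_i$). A cycle is a walk with $k\ge1$, $v_0=v_k$, $e_1,e_k$ forming a transit pair at $v_0$, and (as throughout) all edges distinct (edge-simple). A set $X\subseteq E$ is balanced if for every node $v$ the number of edges of $X$ entering $v$ equals the number of edges of $X$ leaving $v$, where a loop at $v$ entering (resp. leaving) $v$ at both ends is counted twice. A cycle is small if it passes each node at most twice, i.e., its edge set is a balanced set in which each node is entered by at most two edges. -}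

module Defs where

open import Data.Nat using (ℕ; zero; suc; _+_; _≤_)
open import Data.Fin using (Fin; zero; suc; toℕ; fromℕ; inject₁)
open import Data.Fin.Properties using (_≟_; any?)
open import Data.Fin.Subset using (Subset; _∈_)
open import Data.Vec using (lookup; tabulate)
open import Data.List using (map; allFin)
open import Data.Nat.ListAction using (sum)
open import Data.Bool using (Bool; true; false; if_then_else_)
open import Data.Product using (Σ; ∃; _×_)
open import Data.Sum using (_⊎_)
open import Relation.Nullary using (¬_; yes; no)
open import Relation.Nullary.Decidable using (⌊_⌋)
open import Relation.Binary.PropositionalEquality using (_≡_; _≢_)
open import Function.Definitions using (Injective)

data Dir : Set where
  enter leave : Dir

-- Each edge e has two ends end₁ e, end₂ e, and at each end it either
-- enters or leaves. (enter,leave)/(leave,enter) = directed edge,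
-- (leave,leave) = edge leaving both ends, (enter,enter) = entering both.
record BiGraph : Set where
  field
    n m   : ℕ
    end₁  : Fin m → Fin n
    end₂  : Fin m → Fin n
    dir₁  : Fin m → Dir
    dir₂  : Fin m → Dir
    loopOK : ∀ e → end₁ e ≡ end₂ e → dir₁ e ≡ dir₂ e

module _ (G : BiGraph) where
  open BiGraph G

  sameDir : Dir → Dir → Bool
  sameDir enter enter = true
  sameDir leave leave = true
  sameDir _ _ = false

  -- number of ends of e at v where e has direction d (a loop counts twice)
  incid : Fin m → Fin n → Dir → ℕ
  incid e v d =
    (if ⌊ end₁ e ≟ v ⌋ then (if sameDir (dir₁ e) d then 1 else 0) else 0)
    + (if ⌊ end₂ e ≟ v ⌋ then (if sameDir (dir₂ e) d then 1 else 0) else 0)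

  deg : Subset m → Fin n → Dir → ℕ
  deg X v d = sum (map (λ e → if lookup X e then incid e v d else 0) (allFin m))

  Balanced : Subset m → Set
  Balanced X = ∀ v → deg X v enter ≡ deg X v leave

  Connects : Fin m → Fin n → Fin n → Set
  Connects e u w = (end₁ e ≡ u × end₂ e ≡ w) ⊎ (end₂ e ≡ u × end₁ e ≡ w)

  Enters Leaves : Fin m → Fin n → Set
  Enters e v = (end₁ e ≡ v × dir₁ e ≡ enter) ⊎ (end₂ e ≡ v × dir₂ e ≡ enter)
  Leaves e v = (end₁ e ≡ v × dir₁ e ≡ leave) ⊎ (end₂ e ≡ v × dir₂ e ≡ leave)

  TransitPair : Fin m → Fin m → Fin n → Set
  TransitPair e f v = (Enters e v × Leaves f v) ⊎ (Leaves e v × Enters f v)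

  -- A cycle with k = suc j ≥ 1 edges: nodes v₀..v_k, edges e₁..e_k
  -- (0-indexed: node i : Fin (suc k), edge i : Fin k).
  record Cycle : Set where
    field
      j     : ℕ
      node  : Fin (suc (suc j)) → Fin n
      edge  : Fin (suc j) → Fin m
      conn  : ∀ (i : Fin (suc j)) → Connects (edge i) (node (inject₁ i)) (node (suc i))
      trans : ∀ (i i' : Fin (suc j)) → toℕ i' ≡ suc (toℕ i) →
              TransitPair (edge i) (edge i') (node (suc i))
      closed : node zero ≡ node (fromℕ (suc j))
      closeTransit : TransitPair (edge zero) (edge (fromℕ j)) (node zero)
      distinct : Injective _≡_ _≡_ edge

  edgeSet : Cycle → Subset m
  edgeSet C = tabulate (λ e → ⌊ any? (λ i → Cycle.edge C i ≟ e) ⌋)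

  Small : Cycle → Set
  Small C = Balanced (edgeSet C) × (∀ v → deg (edgeSet C) v enter ≤ 2)

  DecomposesIntoSmallCycles : Subset m → Set
  DecomposesIntoSmallCycles X =
    Σ ℕ λ r → Σ (Fin r → Cycle) λ C →
      (∀ a → Small (C a)) ×
      (∀ a b → a ≢ b → ∀ e → e ∈ edgeSet (C a) → ¬ (e ∈ edgeSet (C b))) ×
      (∀ e → (e ∈ X → ∃ λ a → e ∈ edgeSet (C a)) × ((∃ λ a → e ∈ edgeSet (C a)) → e ∈ X))

{-# OPTIONS --safe #-}
module Submission where

-- A port is a node together with a direction.  Traversing an edge leaves it through one end (its
-- source port) and arrives through the other (its target port); a walk may continue with x after y
-- iff y arrives at the port opposite to the source of x, the entry port of x.  Grow a trail in X
-- with distinct edges which uses every port at most once as an entry port.  If the trail arrives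
-- at a port p = (v , d) that is not yet an entry port, counting edge ends shows that it has more
-- ends at v with direction d than with the opposite one, so, X being balanced, an unused edge of X
-- continues the trail.  Otherwise the part of the trail from the traversal entered through p on
-- is a closed trail.  Each of its passages through a node v has one of the two entry ports at v,
-- so it passes v at most twice: it is a small cycle.  Its edge set is balanced, so removing it
-- leaves a balanced set, and induction on the number of edges finishes the proof.

open import Defs
open import Data.Bool using (Bool; true; false; if_then_else_; _∨_; _∧_; not)
import Data.Bool as Bool
open import Data.Bool.Properties using (∨-assoc; ∨-conicalˡ; ∧-zeroʳ; ∧-identityʳ; not-¬)
open import Data.Empty using (⊥-elim)
open import Data.Fin using (Fin; zero; suc; toℕ; fromℕ; inject₁)
open import Data.Fin.Properties using (_≟_; any?; toℕ-injective; toℕ-inject₁)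
open import Data.Fin.Subset using (Subset; _∈_)
open import Data.List using (List; []; _∷_; _++_; length; map; allFin)
import Data.List as List
open import Data.List.Properties using (map-cong; map-tabulate; map-++)
open import Data.Nat using (ℕ; zero; suc; _+_; _≤_; _<_; z≤n; z<s)
open import Data.Nat.Properties
  using ( +-0-commutativeMonoid; +-commutativeSemigroup; +-identityʳ; +-comm; +-assoc; +-suc
        ; +-cancelˡ-≡; +-cancelʳ-≡; +-mono-≤; ≤-reflexive; ≤-trans; <-irrefl; <-≤-trans
        ; m≤m+n; m≤n+m; m<n+m; n<1+n; n≮0; n≤0⇒n≡0; suc-injective; module ≤-Reasoning )
open import Data.Nat.Induction using (<-wellFounded)
open import Data.Nat.ListAction using (sum)
open import Data.Nat.ListAction.Properties using (sum-++)
open import Data.Product using (∃; ∃₂; _×_; _,_; proj₁; proj₂)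
open import Data.Sum using (_⊎_; inj₁; inj₂)
open import Data.Unit using (⊤; tt)
open import Data.Vec using (lookup; tabulate)
open import Data.Vec.Properties using (lookup∘tabulate; tabulate∘lookup; []=⇒lookup; lookup⇒[]=)
open import Function using (_∘_; id)
open import Induction.WellFounded using (Acc; acc)
open import Relation.Nullary using (¬_; yes; no; does)
open import Relation.Nullary.Decidable using (⌊_⌋; dec-true; isYes≗does)
open import Relation.Binary.PropositionalEquality

open import Algebra.Properties.CommutativeMonoid.Sum +-0-commutativeMonoid
  using (sum-syntax; sum-cong-≗; ∑-distrib-+; sum-replicate-zero)
  renaming (sum to ∑)
open import Algebra.Properties.CommutativeSemigroup +-commutativeSemigroup
  using () renaming (interchange to +-interchange)

-- Finite sums

sum-tabulate : ∀ {k} (F : Fin k → ℕ) → sum (List.tabulate F) ≡ ∑[ i < k ] F i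
sum-tabulate {zero}  F = refl
sum-tabulate {suc k} F = cong (F zero +_) (sum-tabulate (F ∘ suc))

sum-map-allFin : ∀ {k} (F : Fin k → ℕ) → sum (map F (allFin k)) ≡ ∑[ i < k ] F i
sum-map-allFin F = trans (cong sum (map-tabulate id F)) (sum-tabulate F)

sum-map-+ : ∀ {A : Set} (f g : A → ℕ) xs →
            sum (map (λ x → f x + g x) xs) ≡ sum (map f xs) + sum (map g xs)
sum-map-+ f g []       = refl
sum-map-+ f g (x ∷ xs) =
  trans (cong (f x + g x +_) (sum-map-+ f g xs)) (+-interchange (f x) (g x) _ _)

sum-map-const-1 : ∀ {A : Set} (xs : List A) → sum (map (λ _ → 1) xs) ≡ length xs
sum-map-const-1 []       = refl
sum-map-const-1 (_ ∷ xs) = cong suc (sum-map-const-1 xs)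

∑-indicator : ∀ {k} (j : Fin k) (w : Fin k → ℕ) →
              ∑[ i < k ] (if does (j ≟ i) then w i else 0) ≡ w j
∑-indicator {suc k} zero    w =
  trans (cong (w zero +_) (sum-replicate-zero k)) (+-identityʳ (w zero))
∑-indicator {suc k} (suc j) w = ∑-indicator j (w ∘ suc)

∑-positive : ∀ {k} (F : Fin k → ℕ) → 0 < ∑[ i < k ] F i → ∃ λ i → 0 < F i
∑-positive {zero}  F ()
∑-positive {suc k} F pos with F zero in eq
... | suc _ = zero , subst (0 <_) (sym eq) z<s
... | zero  = let i , Fi>0 = ∑-positive (F ∘ suc) pos in suc i , Fi>0

positive-remainder : ∀ {a b c d} → a + b ≡ c + d → c < a → 0 < d
positive-remainder {d = suc _} _ _ = z<s
positive-remainder {a} {b} {c} {zero} eq c<a =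
  ⊥-elim (<-irrefl refl
    (<-≤-trans c<a (≤-trans (m≤m+n a b) (≤-reflexive (trans eq (+-identityʳ c))))))

∈-tabulate⁺ : ∀ {k} {F : Fin k → Bool} {i} → F i ≡ true → i ∈ tabulate F
∈-tabulate⁺ {F = F} {i} Fi = lookup⇒[]= i (tabulate F) (trans (lookup∘tabulate F i) Fi)

∈-tabulate⁻ : ∀ {k} {F : Fin k → Bool} {i} → i ∈ tabulate F → F i ≡ true
∈-tabulate⁻ {F = F} {i} i∈F = trans (sym (lookup∘tabulate F i)) ([]=⇒lookup i∈F)

opposite : Dir → Dir
opposite enter = leave
opposite leave = enter

opposite-involutive : ∀ d → opposite (opposite d) ≡ d
opposite-involutive enter = refl
opposite-involutive leave = refl

module _ (G : BiGraph) where
  open BiGraph G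

  -- Ports and traversals

  Port : Set
  Port = Fin n × Dir

  oppositePort : Port → Port
  oppositePort p = proj₁ p , opposite (proj₂ p)

  oppositePort-involutive : ∀ p → oppositePort (oppositePort p) ≡ p
  oppositePort-involutive (v , d) = cong (v ,_) (opposite-involutive d)

  -- Kronecker delta on ports, in the shape that makes incid e v d equal
  -- δ (end₁ e , dir₁ e) (v , d) + δ (end₂ e , dir₂ e) (v , d) by definition.
  δ : Port → Port → ℕ
  δ (w , s) (v , d) = if ⌊ w ≟ v ⌋ then (if sameDir G s d then 1 else 0) else 0

  δ-cases : ∀ p r → δ p r ≡ 0 ⊎ p ≡ r
  δ-cases (w , s) (v , d) with w ≟ v
  ... | no _ = inj₁ refl
  δ-cases (w , enter) (w , enter) | yes refl = inj₂ refl
  δ-cases (w , enter) (w , leave) | yes refl = inj₁ refl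
  δ-cases (w , leave) (w , enter) | yes refl = inj₁ refl
  δ-cases (w , leave) (w , leave) | yes refl = inj₂ refl

  δ-refl : ∀ p → δ p p ≡ 1
  δ-refl (v , d) with v ≟ v
  ... | no v≢v = ⊥-elim (v≢v refl)
  ... | yes _ with d
  ...   | enter = refl
  ...   | leave = refl

  δ-positive : ∀ {p r} → 0 < δ p r → p ≡ r
  δ-positive {p} {r} pos with δ-cases p r
  ... | inj₁ δ≡0 = ⊥-elim (n≮0 (subst (0 <_) δ≡0 pos))
  ... | inj₂ p≡r = p≡r

  δ-oppositePort : ∀ p r → δ p r ≡ δ (oppositePort p) (oppositePort r)
  δ-oppositePort (w , enter) (v , enter) = refl
  δ-oppositePort (w , enter) (v , leave) = refl
  δ-oppositePort (w , leave) (v , enter) = refl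
  δ-oppositePort (w , leave) (v , leave) = refl

  δ-oppositePort-self : ∀ p → δ p (oppositePort p) ≡ 0
  δ-oppositePort-self (v , d) with v ≟ v | d
  ... | yes _ | enter = refl
  ... | yes _ | leave = refl
  ... | no _  | _     = refl

  -- (e , true) runs from end₁ e to end₂ e, and (e , false) the other way round.
  Traversal : Set
  Traversal = Fin m × Bool

  edgeOf : Traversal → Fin m
  edgeOf = proj₁

  source target : Traversal → Port
  source (e , true)  = end₁ e , dir₁ e
  source (e , false) = end₂ e , dir₂ e
  target (e , true)  = end₂ e , dir₂ e
  target (e , false) = end₁ e , dir₁ e

  -- A walk may pass from y to x exactly when target y ≡ entry x.
  entry : Traversal → Port
  entry x = oppositePort (source x)

  incid-traversal : ∀ x v d →
                    incid G (edgeOf x) v d ≡ δ (target x) (v , d) + δ (entry x) (v , opposite d)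
  incid-traversal (e , true) v d =
    trans (cong (_+ δ (end₂ e , dir₂ e) (v , d)) (δ-oppositePort (end₁ e , dir₁ e) (v , d)))
          (+-comm (δ (entry (e , true)) (v , opposite d)) (δ (target (e , true)) (v , d)))
  incid-traversal (e , false) v d =
    cong (δ (end₁ e , dir₁ e) (v , d) +_) (δ-oppositePort (end₂ e , dir₂ e) (v , d))

  HasEnd : Fin m → Port → Set
  HasEnd e (v , d) = (end₁ e ≡ v × dir₁ e ≡ d) ⊎ (end₂ e ≡ v × dir₂ e ≡ d)

  source-end : ∀ x → HasEnd (edgeOf x) (source x)
  source-end (e , true)  = inj₁ (refl , refl)
  source-end (e , false) = inj₂ (refl , refl)

  target-end : ∀ x → HasEnd (edgeOf x) (target x)
  target-end (e , true)  = inj₂ (refl , refl)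
  target-end (e , false) = inj₁ (refl , refl)

  traversal-connects : ∀ x → Connects G (edgeOf x) (proj₁ (target x)) (proj₁ (source x))
  traversal-connects (e , true)  = inj₂ (refl , refl)
  traversal-connects (e , false) = inj₁ (refl , refl)

  transitPair-sym : ∀ {e f v} → TransitPair G e f v → TransitPair G f e v
  transitPair-sym (inj₁ (e-in , f-out)) = inj₂ (f-out , e-in)
  transitPair-sym (inj₂ (e-out , f-in)) = inj₁ (f-in , e-out)

  transitPair-ends : ∀ {e f} p → HasEnd e p → HasEnd f (oppositePort p) →
                     TransitPair G e f (proj₁ p)
  transitPair-ends (v , enter) e-in  f-out = inj₁ (e-in , f-out)
  transitPair-ends (v , leave) e-out f-in  = inj₂ (e-out , f-in)

  consecutive-transitPair : ∀ x y → target y ≡ entry x →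
                            TransitPair G (edgeOf x) (edgeOf y) (proj₁ (source x))
  consecutive-transitPair x y y→x =
    transitPair-ends (source x) (source-end x) (subst (HasEnd (edgeOf y)) y→x (target-end y))

  consecutive-connects : ∀ x y → target y ≡ entry x →
                         Connects G (edgeOf y) (proj₁ (source x)) (proj₁ (source y))
  consecutive-connects x y y→x =
    subst (λ v → Connects G (edgeOf y) v (proj₁ (source y))) (cong proj₁ y→x)
          (traversal-connects y)

  -- Edge sets and degrees

  Edges : Set
  Edges = Fin m → Bool

  _⊆_ : Edges → Edges → Set
  A ⊆ B = ∀ e → A e ≡ true → B e ≡ true

  _∖_ : Edges → Edges → Edges
  (A ∖ B) e = A e ∧ not (B e)

  ∖-member⁻ : ∀ A B {e} → (A ∖ B) e ≡ true → A e ≡ true × B e ≡ false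
  ∖-member⁻ A B {e} A∖Be with A e | B e
  ... | true | false = refl , refl

  ∖-member⁺ : ∀ A B {e} → A e ≡ true → B e ≡ false → (A ∖ B) e ≡ true
  ∖-member⁺ A B Ae Be rewrite Ae | Be = refl

  total : Edges → (Fin m → ℕ) → ℕ
  total A w = ∑[ e < m ] (if A e then w e else 0)

  degree : Edges → Port → ℕ
  degree A p = total A (λ e → incid G e (proj₁ p) (proj₂ p))

  size : Edges → ℕ
  size A = total A (λ _ → 1)

  IsBalanced : Edges → Set
  IsBalanced A = ∀ p → degree A p ≡ degree A (oppositePort p)

  deg≡degree : ∀ S v d → deg G S v d ≡ degree (lookup S) (v , d)
  deg≡degree S v d = sum-map-allFin (λ e → if lookup S e then incid G e v d else 0)

  total-cong : ∀ {A B} w → (∀ e → A e ≡ B e) → total A w ≡ total B w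
  total-cong w A≗B = sum-cong-≗ (λ e → cong (λ b → if b then w e else 0) (A≗B e))

  total-partition : ∀ {A B C} w → (∀ e → A e ≡ B e ∨ C e) → (∀ e → B e ∧ C e ≡ false) →
                    total A w ≡ total B w + total C w
  total-partition {A} {B} {C} w cover disjoint =
    trans (sum-cong-≗ split)
          (∑-distrib-+ (λ e → if B e then w e else 0) (λ e → if C e then w e else 0))
    where
    split : ∀ e → (if A e then w e else 0) ≡ (if B e then w e else 0) + (if C e then w e else 0)
    split e rewrite cover e with B e | C e | disjoint e
    ... | true  | true  | ()
    ... | true  | false | _ = sym (+-identityʳ (w e))
    ... | false | _     | _ = refl

  total-∖ : ∀ {X A} w → A ⊆ X → total X w ≡ total A w + total (X ∖ A) w
  total-∖ {X} {A} w A⊆X = total-partition w cover disjoint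
    where
    cover : ∀ e → X e ≡ A e ∨ (X ∖ A) e
    cover e with A e in Ae
    ... | true  = A⊆X e Ae
    ... | false = sym (∧-identityʳ (X e))
    disjoint : ∀ e → A e ∧ (X ∖ A) e ≡ false
    disjoint e with A e
    ... | true  = ∧-zeroʳ (X e)
    ... | false = refl

  degree-∖ : ∀ {X A} → A ⊆ X → ∀ r → degree X r ≡ degree A r + degree (X ∖ A) r
  degree-∖ A⊆X (v , d) = total-∖ (λ e → incid G e v d) A⊆X

  balanced-∖ : ∀ {X A} → IsBalanced X → IsBalanced A → A ⊆ X → IsBalanced (X ∖ A)
  balanced-∖ {X} {A} bX bA A⊆X r = +-cancelˡ-≡ (degree A r) _ _ (begin
    degree A r + degree (X ∖ A) r     ≡⟨ degree-∖ A⊆X r ⟨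
    degree X r                        ≡⟨ bX r ⟩
    degree X r′                       ≡⟨ degree-∖ A⊆X r′ ⟩
    degree A r′ + degree (X ∖ A) r′   ≡⟨ cong (_+ degree (X ∖ A) r′) (bA r) ⟨
    degree A r + degree (X ∖ A) r′    ∎)
    where
    open ≡-Reasoning
    r′ = oppositePort r

  degree-positive : ∀ A p → 0 < degree A p → ∃ λ y → A (edgeOf y) ≡ true × source y ≡ p
  degree-positive A (v , d) pos with ∑-positive (λ e → if A e then incid G e v d else 0) pos
  ... | e , e>0 with A e in Ae
  ... | false = ⊥-elim (n≮0 e>0)
  ... | true with δ-cases (end₁ e , dir₁ e) (v , d)
  ...   | inj₂ at₁ = (e , true) , Ae , at₁
  ...   | inj₁ δ≡0 = (e , false) , Ae ,
                     δ-positive (subst (λ k → 0 < k + δ (end₂ e , dir₂ e) (v , d)) δ≡0 e>0)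

  -- Trails

  occurs : List Traversal → Edges
  occurs []      e = false
  occurs (x ∷ T) e = does (edgeOf x ≟ e) ∨ occurs T e

  Distinct : List Traversal → Set
  Distinct []      = ⊤
  Distinct (x ∷ T) = occurs T (edgeOf x) ≡ false × Distinct T

  mult : (Traversal → Port) → List Traversal → Port → ℕ
  mult f T r = sum (map (λ x → δ (f x) r) T)

  mult-++ : ∀ f T U r → mult f (T ++ U) r ≡ mult f T r + mult f U r
  mult-++ f T U r =
    trans (cong sum (map-++ (λ x → δ (f x) r) T U)) (sum-++ (map (λ x → δ (f x) r) T) _)

  occurs-++ : ∀ T U e → occurs (T ++ U) e ≡ occurs T e ∨ occurs U e
  occurs-++ []      U e = refl
  occurs-++ (x ∷ T) U e =
    trans (cong (does (edgeOf x ≟ e) ∨_) (occurs-++ T U e))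
          (sym (∨-assoc (does (edgeOf x ≟ e)) (occurs T e) (occurs U e)))

  distinct-++ˡ : ∀ T U → Distinct (T ++ U) → Distinct T
  distinct-++ˡ []      U _            = tt
  distinct-++ˡ (x ∷ T) U (x∉TU , dTU) =
    ∨-conicalˡ _ _ (trans (sym (occurs-++ T U (edgeOf x))) x∉TU) , distinct-++ˡ T U dTU

  total-occurs : ∀ w T → Distinct T → total (occurs T) w ≡ sum (map (w ∘ edgeOf) T)
  total-occurs w []      _          = sum-replicate-zero m
  total-occurs w (x ∷ T) (x∉T , dT) =
    trans (total-partition w (λ _ → refl) disjoint)
          (cong₂ _+_ (∑-indicator (edgeOf x) w) (total-occurs w T dT))
    where
    disjoint : ∀ e → does (edgeOf x ≟ e) ∧ occurs T e ≡ false
    disjoint e with edgeOf x ≟ e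
    ... | yes refl = x∉T
    ... | no _     = refl

  degree-occurs : ∀ T → Distinct T → ∀ v d →
                  degree (occurs T) (v , d) ≡ mult target T (v , d) + mult entry T (v , opposite d)
  degree-occurs T dT v d = begin
    degree (occurs T) (v , d)
      ≡⟨ total-occurs (λ e → incid G e v d) T dT ⟩
    sum (map (λ x → incid G (edgeOf x) v d) T)
      ≡⟨ cong sum (map-cong (λ x → incid-traversal x v d) T) ⟩
    sum (map (λ x → δ (target x) (v , d) + δ (entry x) (v , opposite d)) T)
      ≡⟨ sum-map-+ (λ x → δ (target x) (v , d)) (λ x → δ (entry x) (v , opposite d)) T ⟩
    mult target T (v , d) + mult entry T (v , opposite d) ∎
    where open ≡-Reasoning

  -- Trail p T q: read from last to first, T is a walk that ends by arriving at port p
  -- and whose first traversal has entry port q.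
  data Trail : Port → List Traversal → Port → Set where
    []  : ∀ {p} → Trail p [] p
    _∷_ : ∀ {p q x T} → target x ≡ p → Trail (entry x) T q → Trail p (x ∷ T) q

  trail-balance : ∀ {p T q} → Trail p T q → ∀ r →
                  mult target T r + δ q r ≡ δ p r + mult entry T r
  trail-balance {p} [] r = +-comm 0 (δ p r)
  trail-balance {q = q} (_∷_ {x = x} {T = T} refl t) r = begin
    δ (target x) r + mult target T r + δ q r          ≡⟨ +-assoc (δ (target x) r) _ _ ⟩
    δ (target x) r + (mult target T r + δ q r)        ≡⟨ cong (δ (target x) r +_) (trail-balance t r) ⟩
    δ (target x) r + (δ (entry x) r + mult entry T r) ∎
    where open ≡-Reasoning

  closed-trail-balance : ∀ {p T} → Trail p T p → ∀ r → mult target T r ≡ mult entry T r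
  closed-trail-balance {p} t r =
    +-cancelʳ-≡ (δ p r) _ _ (trans (trail-balance t r) (+-comm (δ p r) _))

  degree-closed-trail : ∀ {p T} → Trail p T p → Distinct T → ∀ v d →
                        degree (occurs T) (v , d) ≡ mult entry T (v , d) + mult entry T (v , opposite d)
  degree-closed-trail {T = T} t dT v d =
    trans (degree-occurs T dT v d)
          (cong (_+ mult entry T (v , opposite d)) (closed-trail-balance t (v , d)))

  closed-trail-balanced : ∀ {p T} → Trail p T p → Distinct T → IsBalanced (occurs T)
  closed-trail-balanced {T = T} t dT (v , d) = begin
    degree (occurs T) (v , d)
      ≡⟨ degree-closed-trail t dT v d ⟩
    mult entry T (v , d) + mult entry T (v , opposite d)
      ≡⟨ +-comm (mult entry T (v , d)) _ ⟩
    mult entry T (v , opposite d) + mult entry T (v , d)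
      ≡⟨ cong (λ d′ → mult entry T (v , opposite d) + mult entry T (v , d′))
              (opposite-involutive d) ⟨
    mult entry T (v , opposite d) + mult entry T (v , opposite (opposite d))
      ≡⟨ degree-closed-trail t dT v (opposite d) ⟨
    degree (occurs T) (v , opposite d) ∎
    where open ≡-Reasoning

  δ-start≤mult-entry : ∀ {p x T q} → Trail p (x ∷ T) q → ∀ r → δ q r ≤ mult entry (x ∷ T) r
  δ-start≤mult-entry (_ ∷ [])                    r = m≤m+n _ 0
  δ-start≤mult-entry {x = x} (_ ∷ t@(_ ∷ _)) r =
    ≤-trans (δ-start≤mult-entry t r) (m≤n+m _ (δ (entry x) r))

  -- By trail-balance such a trail, which cannot start at p since its start is an entry port,
  -- arrives exactly once at p, and at the opposite port at most as often as it enters through it.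
  trail-degree-excess : ∀ {p x T q} → Trail p (x ∷ T) q → Distinct (x ∷ T) →
                        mult entry (x ∷ T) p ≡ 0 →
                        degree (occurs (x ∷ T)) (oppositePort p) < degree (occurs (x ∷ T)) p
  trail-degree-excess {p@(v , d)} {x} {T} {q} t dU unvisited = begin-strict
    degree (occurs U) (v , opposite d)
      ≡⟨ degree-occurs U dU v (opposite d) ⟩
    mult target U p′ + mult entry U (v , opposite (opposite d))
      ≡⟨ cong (λ d′ → mult target U p′ + mult entry U (v , d′)) (opposite-involutive d) ⟩
    mult target U p′ + mult entry U p
      ≡⟨ trans (cong (mult target U p′ +_) unvisited) (+-identityʳ _) ⟩
    mult target U p′
      ≤⟨ targets≤entries ⟩
    mult entry U p′
      <⟨ n<1+n _ ⟩
    1 + mult entry U p′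
      ≡⟨ cong (_+ mult entry U p′) targets≡1 ⟨
    mult target U p + mult entry U p′
      ≡⟨ degree-occurs U dU v d ⟨
    degree (occurs U) p ∎
    where
    open ≤-Reasoning
    U = x ∷ T
    p′ = oppositePort p
    q≢p : δ q p ≡ 0
    q≢p = n≤0⇒n≡0 (subst (δ q p ≤_) unvisited (δ-start≤mult-entry t p))
    targets≡1 : mult target U p ≡ 1
    targets≡1 = +-cancelʳ-≡ 0 _ _ (begin-equality
      mult target U p + 0      ≡⟨ cong (mult target U p +_) q≢p ⟨
      mult target U p + δ q p  ≡⟨ trail-balance t p ⟩
      δ p p + mult entry U p   ≡⟨ cong₂ _+_ (δ-refl p) unvisited ⟩
      1 + 0                    ∎)
    targets≤entries : mult target U p′ ≤ mult entry U p′
    targets≤entries = ≤-trans (m≤m+n _ (δ q p′)) (≤-reflexive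
      (trans (trail-balance t p′) (cong (_+ mult entry U p′) (δ-oppositePort-self p))))

  trail-cut : ∀ {p T q} → Trail p T q → ∀ r → 0 < mult entry T r →
              ∃₂ λ x T₁ → ∃ λ T₂ → T ≡ (x ∷ T₁) ++ T₂ × Trail p (x ∷ T₁) r
  trail-cut [] r ()
  trail-cut (_∷_ {x = x} {T = T} x→p t) r pos with δ-cases (entry x) r
  ... | inj₂ refl = x , [] , T , refl , x→p ∷ []
  ... | inj₁ δ≡0 with trail-cut t r (subst (λ k → 0 < k + mult entry T r) δ≡0 pos)
  ...   | y , T₁ , T₂ , refl , t₁ = x , y ∷ T₁ , T₂ , refl , x→p ∷ t₁

  -- The cycle of a closed trail

  trail-lookup : ∀ {p x T q} → Trail p (x ∷ T) q → (i : Fin (length T)) →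
                 target (List.lookup T i) ≡ entry (List.lookup (x ∷ T) (inject₁ i))
  trail-lookup (_ ∷ (y→x ∷ _)) zero    = y→x
  trail-lookup (_ ∷ t@(_ ∷ _)) (suc i) = trail-lookup t i

  trail-last : ∀ {p x T q} → Trail p (x ∷ T) q →
               entry (List.lookup (x ∷ T) (fromℕ (length T))) ≡ q
  trail-last (_ ∷ [])        = refl
  trail-last (_ ∷ t@(_ ∷ _)) = trail-last t

  occurs-any : ∀ T e → occurs T e ≡ does (any? (λ i → edgeOf (List.lookup T i) ≟ e))
  occurs-any []      e = refl
  occurs-any (x ∷ T) e = cong (does (edgeOf x ≟ e) ∨_) (occurs-any T e)

  occurs-lookup : ∀ T i → occurs T (edgeOf (List.lookup T i)) ≡ true
  occurs-lookup T i = trans (occurs-any T _) (dec-true (any? _) (i , refl))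

  edgeOf-lookup-injective : ∀ T → Distinct T → ∀ i j →
                            edgeOf (List.lookup T i) ≡ edgeOf (List.lookup T j) → i ≡ j
  edgeOf-lookup-injective (x ∷ T) _ zero zero _ = refl
  edgeOf-lookup-injective (x ∷ T) (x∉T , _) zero (suc j) eq =
    ⊥-elim (not-¬ (subst (λ e → occurs T e ≡ true) (sym eq) (occurs-lookup T j)) x∉T)
  edgeOf-lookup-injective (x ∷ T) (x∉T , _) (suc i) zero eq =
    ⊥-elim (not-¬ (subst (λ e → occurs T e ≡ true) eq (occurs-lookup T i)) x∉T)
  edgeOf-lookup-injective (x ∷ T) (_ , dT) (suc i) (suc j) eq =
    cong suc (edgeOf-lookup-injective T dT i j eq)

  -- The cycle runs through T in list order, that is, along the walk backwards.
  toCycle : ∀ {p x T} → Trail p (x ∷ T) p → Distinct (x ∷ T) → Cycle G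
  toCycle {p} {x} {T} t@(x→p ∷ _) dT = record
    { j            = length T
    ; node         = node
    ; edge         = edge
    ; conn         = conn
    ; trans        = transit
    ; closed       = sym (cong proj₁ (trail-last t))
    ; closeTransit = transitPair-sym
        (subst (TransitPair G (edge last) (edgeOf x)) (cong proj₁ (trail-last t))
               (consecutive-transitPair (List.lookup (x ∷ T) last) x
                                        (trans x→p (sym (trail-last t)))))
    ; distinct     = λ {i} {j} → edgeOf-lookup-injective (x ∷ T) dT i j
    }
    where
    last : Fin (suc (length T))
    last = fromℕ (length T)
    edge : Fin (suc (length T)) → Fin m
    edge i = edgeOf (List.lookup (x ∷ T) i)
    node : Fin (suc (suc (length T))) → Fin n
    node zero    = proj₁ p
    node (suc i) = proj₁ (source (List.lookup (x ∷ T) i))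
    conn : ∀ i → Connects G (edge i) (node (inject₁ i)) (node (suc i))
    conn zero    = subst (λ v → Connects G (edgeOf x) v (proj₁ (source x))) (cong proj₁ x→p)
                         (traversal-connects x)
    conn (suc i) =
      consecutive-connects (List.lookup (x ∷ T) (inject₁ i)) (List.lookup T i) (trail-lookup t i)
    transit : ∀ i i′ → toℕ i′ ≡ suc (toℕ i) → TransitPair G (edge i) (edge i′) (node (suc i))
    transit i zero     ()
    transit i (suc i′) i′≡1+i with toℕ-injective (trans (toℕ-inject₁ i′) (suc-injective i′≡1+i))
    ... | refl = consecutive-transitPair (List.lookup (x ∷ T) (inject₁ i′)) (List.lookup T i′)
                                         (trail-lookup t i′)

  edgeSet-toCycle : ∀ {p x T} (t : Trail p (x ∷ T) p) (dT : Distinct (x ∷ T)) e →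
                    lookup (edgeSet G (toCycle t dT)) e ≡ occurs (x ∷ T) e
  edgeSet-toCycle {x = x} {T} t@(_ ∷ _) dT e =
    trans (lookup∘tabulate _ e) (trans (isYes≗does _) (sym (occurs-any (x ∷ T) e)))

  deg-toCycle : ∀ {p x T} (t : Trail p (x ∷ T) p) (dT : Distinct (x ∷ T)) v d →
                deg G (edgeSet G (toCycle t dT)) v d ≡ degree (occurs (x ∷ T)) (v , d)
  deg-toCycle t dT v d = trans (deg≡degree (edgeSet G (toCycle t dT)) v d)
                               (total-cong (λ e → incid G e v d) (edgeSet-toCycle t dT))

  small-toCycle : ∀ {p x T} (t : Trail p (x ∷ T) p) (dT : Distinct (x ∷ T)) →
                  (∀ r → mult entry (x ∷ T) r ≤ 1) → Small G (toCycle t dT)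
  small-toCycle t dT entries≤1 = balanced , entered≤2
    where
    balanced : Balanced G (edgeSet G (toCycle t dT))
    balanced v = trans (deg-toCycle t dT v enter)
                       (trans (closed-trail-balanced t dT (v , enter)) (sym (deg-toCycle t dT v leave)))
    entered≤2 : ∀ v → deg G (edgeSet G (toCycle t dT)) v enter ≤ 2
    entered≤2 v =
      subst (_≤ 2) (sym (trans (deg-toCycle t dT v enter) (degree-closed-trail t dT v enter)))
            (+-mono-≤ (entries≤1 (v , enter)) (entries≤1 (v , leave)))

  -- Growing a trail until it closes

  record Admissible (X : Edges) (T : List Traversal) : Set where
    field
      distinct  : Distinct T
      entries≤1 : ∀ r → mult entry T r ≤ 1
      occurs⊆X  : occurs T ⊆ X
  open Admissible

  admissible-[] : ∀ {X} → Admissible X []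
  admissible-[] = record { distinct = tt ; entries≤1 = λ _ → z≤n ; occurs⊆X = λ _ () }

  admissible-∷ : ∀ {X T y} → Admissible X T → (X ∖ occurs T) (edgeOf y) ≡ true →
                 mult entry T (entry y) ≡ 0 → Admissible X (y ∷ T)
  admissible-∷ {X} {T} {y} a fresh unvisited = record
    { distinct  = proj₂ (∖-member⁻ X (occurs T) fresh) , distinct a
    ; entries≤1 = entries≤1′
    ; occurs⊆X  = occurs⊆X′
    }
    where
    entries≤1′ : ∀ r → δ (entry y) r + mult entry T r ≤ 1
    entries≤1′ r with δ-cases (entry y) r
    ... | inj₁ δ≡0  = subst (λ k → k + mult entry T r ≤ 1) (sym δ≡0) (entries≤1 a r)
    ... | inj₂ refl = ≤-reflexive (cong₂ _+_ (δ-refl (entry y)) unvisited)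
    occurs⊆X′ : occurs (y ∷ T) ⊆ X
    occurs⊆X′ e y∷T∋e with edgeOf y ≟ e
    ... | yes refl = proj₁ (∖-member⁻ X (occurs T) fresh)
    ... | no _     = occurs⊆X a e y∷T∋e

  admissible-++ˡ : ∀ {X} T U → Admissible X (T ++ U) → Admissible X T
  admissible-++ˡ T U a = record
    { distinct  = distinct-++ˡ T U (distinct a)
    ; entries≤1 = λ r → ≤-trans (m≤m+n _ _) (subst (_≤ 1) (mult-++ entry T U r) (entries≤1 a r))
    ; occurs⊆X  = λ e T∋e → occurs⊆X a e (trans (occurs-++ T U e) (cong (_∨ occurs U e) T∋e))
    }

  size-∖-occurs : ∀ {X T} → Admissible X T → size X ≡ length T + size (X ∖ occurs T)
  size-∖-occurs {X} {T} a =
    trans (total-∖ (λ _ → 1) (occurs⊆X a))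
          (cong (_+ size (X ∖ occurs T))
                (trans (total-occurs (λ _ → 1) T (distinct a)) (sum-map-const-1 T)))

  size-∖-∷ : ∀ {X T y} → Admissible X T → Admissible X (y ∷ T) →
             size (X ∖ occurs (y ∷ T)) < size (X ∖ occurs T)
  size-∖-∷ {X} {T} {y} a a′ = ≤-reflexive (+-cancelˡ-≡ (length T) _ _ (begin
    length T + suc (size (X ∖ occurs (y ∷ T))) ≡⟨ +-suc (length T) _ ⟩
    suc (length T) + size (X ∖ occurs (y ∷ T)) ≡⟨ size-∖-occurs a′ ⟨
    size X                                     ≡⟨ size-∖-occurs a ⟩
    length T + size (X ∖ occurs T)             ∎))
    where open ≡-Reasoning

  size-∖-nonempty : ∀ {X x T} → Admissible X (x ∷ T) → size (X ∖ occurs (x ∷ T)) < size X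
  size-∖-nonempty {X} {x} {T} a =
    subst (size (X ∖ occurs (x ∷ T)) <_) (sym (size-∖-occurs a)) (m<n+m _ z<s)

  ClosedTrailIn : Edges → Set
  ClosedTrailIn X = ∃ λ p → ∃₂ λ x T → Trail p (x ∷ T) p × Admissible X (x ∷ T)

  module _ {X : Edges} (balanced : IsBalanced X) where

    trail-extension : ∀ {p x T q} → Trail p (x ∷ T) q → Admissible X (x ∷ T) →
                      mult entry (x ∷ T) p ≡ 0 →
                      ∃ λ y → (X ∖ occurs (x ∷ T)) (edgeOf y) ≡ true × entry y ≡ p
    trail-extension {p} {x} {T} t a unvisited
      with degree-positive (X ∖ U) (oppositePort p)
             (positive-remainder split (trail-degree-excess t (distinct a) unvisited))
      where
      U = occurs (x ∷ T)
      split : degree U p + degree (X ∖ U) p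
                ≡ degree U (oppositePort p) + degree (X ∖ U) (oppositePort p)
      split = trans (sym (degree-∖ (occurs⊆X a) p))
                    (trans (balanced p) (degree-∖ (occurs⊆X a) (oppositePort p)))
    ... | y , fresh , y-from = y , fresh , trans (cong oppositePort y-from) (oppositePort-involutive p)

    grow : ∀ {p x T q} → Trail p (x ∷ T) q → Admissible X (x ∷ T) →
           Acc _<_ (size (X ∖ occurs (x ∷ T))) → ClosedTrailIn X
    grow {p} {x} {T} t a (acc smaller) with mult entry (x ∷ T) p in revisits
    ... | suc _ with trail-cut t p (subst (0 <_) (sym revisits) z<s)
    ...   | y , T₁ , T₂ , refl , closed = p , y , T₁ , closed , admissible-++ˡ (y ∷ T₁) T₂ a
    grow {p} {x} {T} t a (acc smaller) | zero with trail-extension t a revisits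
    ...   | y , fresh , y→p =
      grow (refl ∷ subst (λ r → Trail r (x ∷ T) _) (sym y→p) t) a′ (smaller (size-∖-∷ a a′))
      where
      a′ : Admissible X (y ∷ x ∷ T)
      a′ = admissible-∷ a fresh (subst (λ r → mult entry (x ∷ T) r ≡ 0) (sym y→p) revisits)

    closed-trail : ∀ {e} → X e ≡ true → ClosedTrailIn X
    closed-trail {e} Xe =
      grow {x = e , true} (refl ∷ []) (admissible-∷ admissible-[] (cong (_∧ true) Xe) refl)
           (<-wellFounded _)

  -- Decomposition

  decomposition-∷ : ∀ {X A} (C : Cycle G) → Small G C → (∀ e → lookup (edgeSet G C) e ≡ A e) →
                    A ⊆ X → DecomposesIntoSmallCycles G (tabulate (X ∖ A)) →
                    DecomposesIntoSmallCycles G (tabulate X)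
  decomposition-∷ {X} {A} C small C≗A A⊆X (r , Cs , smalls , disjoint , cover) =
    suc r , cycles , smalls′ , disjoint′ , λ e → to e , from e
    where
    cycles : Fin (suc r) → Cycle G
    cycles zero    = C
    cycles (suc a) = Cs a
    onC : ∀ {e} → e ∈ edgeSet G C → A e ≡ true
    onC {e} e∈C = trans (sym (C≗A e)) ([]=⇒lookup e∈C)
    onCs : ∀ {e} b → e ∈ edgeSet G (Cs b) → (X ∖ A) e ≡ true
    onCs {e} b e∈Cb = ∈-tabulate⁻ (proj₂ (cover e) (b , e∈Cb))
    apart : ∀ {e} b → e ∈ edgeSet G C → ¬ (e ∈ edgeSet G (Cs b))
    apart b e∈C e∈Cb = not-¬ (onC e∈C) (proj₂ (∖-member⁻ X A (onCs b e∈Cb)))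
    smalls′ : ∀ a → Small G (cycles a)
    smalls′ zero    = small
    smalls′ (suc a) = smalls a
    disjoint′ : ∀ a b → a ≢ b → ∀ e → e ∈ edgeSet G (cycles a) → ¬ (e ∈ edgeSet G (cycles b))
    disjoint′ zero    zero    a≢b            = ⊥-elim (a≢b refl)
    disjoint′ zero    (suc b) _   e e∈C e∈Cb = apart b e∈C e∈Cb
    disjoint′ (suc a) zero    _   e e∈Ca e∈C = apart a e∈C e∈Ca
    disjoint′ (suc a) (suc b) a≢b            = disjoint a b (a≢b ∘ cong suc)
    to : ∀ e → e ∈ tabulate X → ∃ λ a → e ∈ edgeSet G (cycles a)
    to e e∈X with A e in Ae
    ... | true  = zero , lookup⇒[]= e (edgeSet G C) (trans (C≗A e) Ae)
    ... | false with proj₁ (cover e) (∈-tabulate⁺ (∖-member⁺ X A (∈-tabulate⁻ e∈X) Ae))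
    ...   | b , e∈Cb = suc b , e∈Cb
    from : ∀ e → (∃ λ a → e ∈ edgeSet G (cycles a)) → e ∈ tabulate X
    from e (zero  , e∈C)  = ∈-tabulate⁺ (A⊆X e (onC e∈C))
    from e (suc b , e∈Cb) = ∈-tabulate⁺ (proj₁ (∖-member⁻ X A (onCs b e∈Cb)))

  decompose : ∀ X → IsBalanced X → Acc _<_ (size X) → DecomposesIntoSmallCycles G (tabulate X)
  decompose X balanced (acc smaller) with any? (λ e → X e Bool.≟ true)
  ... | no X≡∅ =
    0 , (λ ()) , (λ ()) , (λ ()) ,
    λ e → (λ e∈X → ⊥-elim (X≡∅ (e , ∈-tabulate⁻ e∈X))) , λ { (() , _) }
  ... | yes (e , Xe) with closed-trail balanced Xe
  ...   | p , x , T , t , a =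
    decomposition-∷ (toCycle t (distinct a)) (small-toCycle t (distinct a) (entries≤1 a))
                    (edgeSet-toCycle t (distinct a)) (occurs⊆X a)
                    (decompose (X ∖ occurs (x ∷ T))
                       (balanced-∖ balanced (closed-trail-balanced t (distinct a)) (occurs⊆X a))
                       (smaller (size-∖-nonempty a)))

  balanced-lookup : ∀ X → Balanced G X → IsBalanced (lookup X)
  balanced-lookup X bal (v , enter) =
    trans (sym (deg≡degree X v enter)) (trans (bal v) (deg≡degree X v leave))
  balanced-lookup X bal (v , leave) =
    trans (sym (deg≡degree X v leave)) (trans (sym (bal v)) (deg≡degree X v enter))

lemma2 : (G : BiGraph) (X : Subset (BiGraph.m G)) →
    Balanced G X → DecomposesIntoSmallCycles G X
lemma2 G X balanced =
  subst (DecomposesIntoSmallCycles G) (tabulate∘lookup X)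
        (decompose G (lookup X) (balanced-lookup G X balanced) (<-wellFounded _))
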